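{- For all integers $m,n$, \[ (\Phi^{(\beta)}_m)^\ast\phi^{[\beta]}_n+\phi^{[\beta]}_n(\Phi^{(\beta)}_m)^\ast =(\Phi^{[\beta]}_m)^\ast\phi^{(\beta)}_n+\phi^{(\beta)}_n(\Phi^{[\beta]}_m)^\ast =\delta_{m,n}. \]
   Context: Let $\beta$ be an indeterminate. Let $\mathcal{A}$ be the associative $\mathbb{Q}(\beta)$-algebra generated by the neutral fermions $\phi_n$ ($n\in\mathbb{Z}$) subject to $\phi_m\phi_n+\phi_n\phi_m=2(-1)^m\delta_{m+n,0}$; infinite linear combinations of the $\phi_n$ are allowed in the natural completion in which the expressions below make sense. Let $X\mapsto X^\ast$ be the anti-algebra involution of $\mathcal{A}$ with $\phi_n^\ast=(-1)^n\phi_{ -n}$ and $(XY)^\ast=Y^\ast X^\ast$. The $\beta$-deformed fermions $\phi^{(\beta)}_n,\phi^{[\beta]}_n$ are defined by the generating series identities $\sum_{n\ge0}\phi^{(\beta)}_nz^n=\sum_{n\ge0}\phi_n(z+\tfrac{\beta}{2})^n$, $\sum_{n\ge1}\phi^{(\beta)}_{ -n}z^{ -n}=\sum_{n\ge1}\phi_{ -n}\big(\tfrac{z^{ -1}}{1+\frac{\beta}{2}z^{ -1}}\big)^n$, $\sum_{n\ge1}\phi^{[\beta]}_nz^n=\sum_{n\ge1}\phi_n\big(\tfrac{z}{1+\frac{\beta}{2}z}\big)^n$, $\sum_{n\ge0}\phi^{[\beta]}_{ -n}z^{ -n}=\sum_{n\ge0}\phi_{ -n}(z^{ -1}+\tfrac{\beta}{2})^n$.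 Further, $\Phi^{(\beta)}_n=\sum_{k\ge0}\tfrac12(-\tfrac{\beta}{2})^k\phi^{(\beta)}_{n+k}$ and $\Phi^{[\beta]}_n=\sum_{k\ge0}\tfrac12(-\tfrac{\beta}{2})^k\phi^{[\beta]}_{n-k}$; equivalently $\sum_n\Phi^{(\beta)}_nz^n=\frac{1}{2+\beta z^{ -1}}\sum_n\phi^{(\beta)}_nz^n$ and $\sum_n\Phi^{[\beta]}_nz^n=\frac{1}{2+\beta z}\sum_n\phi^{[\beta]}_nz^n$. -}

module Defs where


open import Algebra.Bundles using (CommutativeRing)
open import Data.Nat as ℕ using (ℕ; zero; suc; _∸_)
open import Data.Nat.Combinatorics using (_C_)
open import Data.Integer as ℤ using (ℤ; +_; -[1+_]; ∣_∣)
open import Data.Bool using (if_then_else_)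
open import Relation.Nullary.Decidable using (⌊_⌋)
open import Relation.Binary.PropositionalEquality using (_≡_)
open import Data.Product using (Σ; _×_)
open import Data.Sum using (_⊎_)

-- All constructions are over a commutative ring R containing an element
-- `beta` (the deformation parameter) and an element `half` with
-- half * (1 + 1) = 1 (i.e. 1/2).
module Fermions {c ℓ} (R : CommutativeRing c ℓ) (beta half : CommutativeRing.Carrier R) where
  open CommutativeRing R hiding (zero)

  pow : Carrier → ℕ → Carrier
  pow x zero = 1#
  pow x (suc n) = x * pow x n

  nat : ℕ → Carrier
  nat zero = 0#
  nat (suc n) = 1# + nat n

  sgn : ℕ → Carrier
  sgn zero = 1#
  sgn (suc n) = - sgn n

  sgnℤ : ℤ → Carrier
  sgnℤ z = sgn ∣ z ∣

  sumN : ℕ → (ℕ → Carrier) → Carrier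
  sumN zero f = 0#
  sumN (suc n) f = sumN n f + f n

  sumRange : ℤ → ℕ → (ℤ → Carrier) → Carrier
  sumRange L n f = sumN n (λ t → f (L ℤ.+ + t))

  b : Carrier
  b = beta * half

  δ : ℤ → ℤ → Carrier
  δ m n = if ⌊ m ℤ.≟ n ⌋ then 1# else 0#

  -- An element of the (completed) linear span of the φ_j is its
  -- coefficient function j ↦ (coefficient of φ_j).
  Lin : Set c
  Lin = ℤ → Carrier

  cond : ℕ → ℕ → Carrier
  cond k N = if ⌊ k ℕ.≤? N ⌋ then nat (N C k) * pow b (N ∸ k) else 0#

  condNeg : ℕ → ℕ → Carrier
  condNeg K J = if ⌊ J ℕ.≤? K ⌋ then sgn (K ∸ J) * nat (K C (K ∸ J)) * pow b (K ∸ J) else 0#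

  -- From Σ_{n≥0} φ^{(β)}_n z^n = Σ_{n≥0} φ_n (z+b)^n :
  --   φ^{(β)}_K = Σ_{j≥K} C(j,K) b^{j-K} φ_j          (K ≥ 0)
  -- From Σ_{n≥1} φ^{(β)}_{-n} z^{-n} = Σ_{n≥1} φ_{-n} (z^{-1}/(1+b z^{-1}))^n :
  --   φ^{(β)}_{-(k+1)} = Σ_{n=0}^{k} (-1)^{k-n} C(k,k-n) b^{k-n} φ_{-(n+1)}
  phiP : ℤ → Lin
  phiP (+ K) (+ J) = cond K J
  phiP (+ K) -[1+ n ] = 0#
  phiP -[1+ k ] (+ J) = 0#
  phiP -[1+ k ] -[1+ n ] = condNeg k n

  -- From Σ_{n≥1} φ^{[β]}_n z^n = Σ_{n≥1} φ_n (z/(1+b z))^n :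
  --   φ^{[β]}_{K+1} = Σ_{j=0}^{K} (-1)^{K-j} C(K,K-j) b^{K-j} φ_{j+1}
  -- From Σ_{n≥0} φ^{[β]}_{-n} z^{-n} = Σ_{n≥0} φ_{-n} (z^{-1}+b)^n :
  --   φ^{[β]}_{-k} = Σ_{N≥k} C(N,k) b^{N-k} φ_{-N}     (k ≥ 0)
  negPart : ℕ → Lin
  negPart k (+ zero) = cond k zero
  negPart k (+ suc _) = 0#
  negPart k -[1+ n ] = cond k (suc n)

  phiB : ℤ → Lin
  phiB (+ zero) j = negPart zero j
  phiB (+ suc K) (+ zero) = 0#
  phiB (+ suc K) (+ suc J) = condNeg K J
  phiB (+ suc K) -[1+ _ ] = 0#
  phiB -[1+ k ] j = negPart (suc k) j

  -- Φ^{(β)}_m = Σ_{k≥0} ½ (-b)^k φ^{(β)}_{m+k}.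
  -- The coefficient of φ_j only receives contributions from k ≤ |j - m|
  -- (φ^{(β)}_K has no φ_j component for K > j), so the sum is truncated there.
  PhiP : ℤ → Lin
  PhiP m j = sumN (suc ∣ j ℤ.- m ∣) (λ k → half * pow (- b) k * phiP (m ℤ.+ + k) j)

  -- Φ^{[β]}_m = Σ_{k≥0} ½ (-b)^k φ^{[β]}_{m-k}.
  -- (φ^{[β]}_K has no φ_j component for K < j, so terms k > |m - j| vanish.)
  PhiB : ℤ → Lin
  PhiB m j = sumN (suc ∣ m ℤ.- j ∣) (λ k → half * pow (- b) k * phiB (m ℤ.- + k) j)

  -- the anti-involution on linear combinations: φ_n* = (-1)^n φ_{-n},
  -- so (Σ a_n φ_n)* = Σ_j (-1)^j a_{-j} φ_j
  star : Lin → Lin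
  star x j = sgnℤ j * x (ℤ.- j)

  -- XY + YX for X = Σ x_i φ_i, Y = Σ y_j φ_j equals
  -- Σ_i 2 (-1)^i x_i y_{-i}  (using φ_iφ_j + φ_jφ_i = 2(-1)^i δ_{i+j,0}).
  -- anticommTerm x y i is the i-th summand.
  anticommTerm : Lin → Lin → ℤ → Carrier
  anticommTerm x y i = (1# + 1#) * sgnℤ i * x i * y (ℤ.- i)

  HasSum : (ℤ → Carrier) → Carrier → Set ℓ
  HasSum f s = Σ ℤ λ L → Σ ℕ λ n →
    ((i : ℤ) → (i ℤ.< L ⊎ L ℤ.+ + n ℤ.≤ i) → f i ≈ 0#) × (sumRange L n f ≈ s)

{-# OPTIONS --safe #-}
module Submission where

-- Write X[j] for the coefficient of φⱼ in X. The anticommutator of (Σᵢ xᵢφᵢ)* and Σⱼ yⱼφⱼ is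
-- Σⱼ 2xⱼyⱼ, and φ^{[β]}_n[j] = φ^{(β)}_{-n}[-j], so both identities reduce to
-- Σⱼ 2 Φ^{(β)}_m[j] φ^{[β]}_n[j] = δ_{m,n}. The coefficients obey the Pascal rule
-- φ^{(β)}_K[j+1] = φ^{(β)}_{K-1}[j] + (β/2) φ^{(β)}_K[j], hence so do those of Φ^{(β)}, while φ^{[β]}
-- obeys the mirrored rule; summation by parts then shows that the sum is unchanged when m and n
-- are both lowered by one. Since Φ^{(β)}_m[j] = 0 for j < m and φ^{[β]}_n[j] = 0 for j > n, the sum
-- is 0 for n < m and 2·½·1 for n = m. For n = m + r + 1 shift to n = 1: there φ^{[β]}_1 = φ₁, and
-- 2Φ^{(β)}_{-r}[1] = (-β/2)ʳ(β/2) + (-β/2)ʳ⁺¹ = 0.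

open import Defs
open import Algebra.Bundles using (CommutativeRing)
open import Data.Integer as ℤ using (ℤ; +_; -[1+_]; ∣_∣; 0ℤ; 1ℤ; -1ℤ)
open import Data.Product using (_×_; _,_)

import Algebra.Properties.CommutativeSemigroup as CommutativeSemigroupProperties
import Algebra.Properties.Ring as RingProperties
import Data.Integer.Properties as ℤ
import Data.Integer.Tactic.RingSolver as ℤ-Solver
open import Data.Nat as ℕ using (ℕ; zero; suc; _∸_)
open import Data.Nat.Combinatorics using (_C_; nCn≡1; nCk≡nC[n∸k]; nCk+nC[k+1]≡[n+1]C[k+1])
open import Data.Nat.Combinatorics.Specification using (k>n⇒nCk≡0)
import Data.Nat.Properties as ℕ
open import Data.Sum using (_⊎_; inj₁; inj₂)
open import Relation.Binary.Bundles using (Setoid)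
open import Relation.Binary.PropositionalEquality as ≡ using (_≡_; _≢_)
open import Relation.Nullary using (yes; no)
open import Relation.Nullary.Negation using (contradiction)

module _ {a ℓ} (S : Setoid a ℓ) where
  open Setoid S

  pred-invariant⇒constant : (f : ℤ → Carrier) → (∀ i → f (ℤ.pred i) ≈ f i) → ∀ i j → f i ≈ f j
  pred-invariant⇒constant f inv i j = trans (≈at0 i) (sym (≈at0 j))
    where
    ≈at0 : ∀ i → f i ≈ f 0ℤ
    ≈at0 (+ zero)      = refl
    ≈at0 (+ suc k)     = trans (sym (inv (+ suc k))) (≈at0 (+ k))
    ≈at0 -[1+ zero ]   = inv 0ℤ
    ≈at0 -[1+ suc k ]  = trans (inv -[1+ k ]) (≈at0 -[1+ k ])

m+[n-m]≡n : ∀ m n → m ℤ.+ (n ℤ.- m) ≡ n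
m+[n-m]≡n = ℤ-Solver.solve-∀

-i+[1+i]≡1 : ∀ i → ℤ.- i ℤ.+ (1ℤ ℤ.+ i) ≡ 1ℤ
-i+[1+i]≡1 = ℤ-Solver.solve-∀

data Offset (m : ℤ) : ℤ → Set where
  above : ∀ d → Offset m (m ℤ.+ + d)
  below : ∀ k → Offset m (m ℤ.+ -[1+ k ])

offset : ∀ m n → Offset m n
offset m n = ≡.subst (Offset m) (m+[n-m]≡n m n) (classify (n ℤ.- m))
  where
  classify : ∀ i → Offset m (m ℤ.+ i)
  classify (+ d)      = above d
  classify -[1+ k ]   = below k

i≤+∣i∣ : ∀ i → i ℤ.≤ + ∣ i ∣
i≤+∣i∣ (+ n)     = ℤ.≤-refl
i≤+∣i∣ -[1+ n ]  = ℤ.-≤+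

∣j-m∣<k⇒j<m+k : ∀ {j m k} → ∣ j ℤ.- m ∣ ℕ.< k → j ℤ.< m ℤ.+ + k
∣j-m∣<k⇒j<m+k {j} {m} lt =
  ≡.subst (ℤ._< _) (m+[n-m]≡n m j) (ℤ.+-monoʳ-< m (ℤ.≤-<-trans (i≤+∣i∣ (j ℤ.- m)) (ℤ.+<+ lt)))

module FermionsProperties {c ℓ} (R : CommutativeRing c ℓ) (beta half : CommutativeRing.Carrier R) where
  open CommutativeRing R hiding (zero)
  open Fermions R beta half
  open RingProperties ring using (-‿distribˡ-*; -‿distribʳ-*; -‿involutive)
  open CommutativeSemigroupProperties *-commutativeSemigroup using (x∙yz≈y∙xz)
  open CommutativeSemigroupProperties +-commutativeSemigroup
    using () renaming (xy∙z≈xz∙y to +-xy∙z≈xz∙y; interchange to +-interchange)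
  open import Relation.Binary.Reasoning.Setoid setoid

  +-*-zeroʳ : ∀ x y → x + y * 0# ≈ x
  +-*-zeroʳ x y = trans (+-congˡ (zeroʳ y)) (+-identityʳ x)

  neg-*-cancel : ∀ x y → - x * y + x * y ≈ 0#
  neg-*-cancel x y = trans (sym (distribʳ y (- x) x)) (trans (*-congʳ (-‿inverseˡ x)) (zeroˡ y))

  nat-+ : ∀ m n → nat (m ℕ.+ n) ≈ nat m + nat n
  nat-+ zero    n = sym (+-identityˡ _)
  nat-+ (suc m) n = trans (+-congˡ (nat-+ m n)) (sym (+-assoc _ _ _))

  sgn*pow≈pow-neg : ∀ x r → sgn r * pow x r ≈ pow (- x) r
  sgn*pow≈pow-neg x zero    = *-identityˡ 1#
  sgn*pow≈pow-neg x (suc r) = begin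
    - sgn r * (x * pow x r)   ≈⟨ -‿distribˡ-* _ _ ⟨
    - (sgn r * (x * pow x r)) ≈⟨ -‿cong (x∙yz≈y∙xz _ _ _) ⟩
    - (x * (sgn r * pow x r)) ≈⟨ -‿distribˡ-* _ _ ⟩
    - x * (sgn r * pow x r)   ≈⟨ *-congˡ (sgn*pow≈pow-neg x r) ⟩
    - x * pow (- x) r         ∎

  sgn*sgn≈1 : ∀ k → sgn k * sgn k ≈ 1#
  sgn*sgn≈1 zero    = *-identityˡ 1#
  sgn*sgn≈1 (suc k) = begin
    - sgn k * - sgn k     ≈⟨ -‿distribˡ-* _ _ ⟨
    - (sgn k * - sgn k)   ≈⟨ -‿cong (-‿distribʳ-* _ _) ⟨
    - - (sgn k * sgn k)   ≈⟨ -‿involutive _ ⟩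
    sgn k * sgn k         ≈⟨ sgn*sgn≈1 k ⟩
    1#                    ∎

  sumN-cong : ∀ n {f g : ℕ → Carrier} → (∀ {t} → t ℕ.< n → f t ≈ g t) → sumN n f ≈ sumN n g
  sumN-cong zero    f≈g = refl
  sumN-cong (suc n) f≈g = +-cong (sumN-cong n (λ t<n → f≈g (ℕ.m<n⇒m<1+n t<n))) (f≈g (ℕ.n<1+n n))

  sumN-vanishes : ∀ n {f : ℕ → Carrier} → (∀ {t} → t ℕ.< n → f t ≈ 0#) → sumN n f ≈ 0#
  sumN-vanishes zero    f≈0 = refl
  sumN-vanishes (suc n) f≈0 =
    trans (+-cong (sumN-vanishes n (λ t<n → f≈0 (ℕ.m<n⇒m<1+n t<n))) (f≈0 (ℕ.n<1+n n))) (+-identityʳ 0#)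

  sumN-extend : ∀ r {n} {f : ℕ → Carrier} → (∀ {t} → n ℕ.≤ t → f t ≈ 0#) → sumN (r ℕ.+ n) f ≈ sumN n f
  sumN-extend zero    f≈0 = refl
  sumN-extend (suc r) {n} {f} f≈0 = begin
    sumN (r ℕ.+ n) f + f (r ℕ.+ n) ≈⟨ +-cong (sumN-extend r f≈0) (f≈0 (ℕ.m≤n+m n r)) ⟩
    sumN n f + 0#                  ≈⟨ +-identityʳ _ ⟩
    sumN n f                       ∎

  sumN-+ : ∀ n (f g : ℕ → Carrier) → sumN n (λ t → f t + g t) ≈ sumN n f + sumN n g
  sumN-+ zero    f g = sym (+-identityʳ 0#)
  sumN-+ (suc n) f g = trans (+-congʳ (sumN-+ n f g)) (+-interchange _ _ _ _)

  sumN-*ˡ : ∀ n x (f : ℕ → Carrier) → sumN n (λ t → x * f t) ≈ x * sumN n f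
  sumN-*ˡ zero    x f = sym (zeroʳ x)
  sumN-*ˡ (suc n) x f = trans (+-congʳ (sumN-*ˡ n x f)) (sym (distribˡ x _ _))

  sumN-suc : ∀ n (f : ℕ → Carrier) → sumN (suc n) f ≈ f 0 + sumN n (λ t → f (suc t))
  sumN-suc zero    f = +-comm 0# (f 0)
  sumN-suc (suc n) f = trans (+-congʳ (sumN-suc n f)) (+-assoc _ _ _)

  sumN-reverse : ∀ n (f : ℕ → Carrier) → sumN n f ≈ sumN n (λ t → f (n ∸ suc t))
  sumN-reverse zero    f = refl
  sumN-reverse (suc n) f = begin
    sumN n f + f n                      ≈⟨ +-congʳ (sumN-reverse n f) ⟩
    sumN n (λ t → f (n ∸ suc t)) + f n  ≈⟨ +-comm _ _ ⟩
    f n + sumN n (λ t → f (n ∸ suc t))  ≈⟨ sumN-suc n (λ t → f (suc n ∸ suc t)) ⟨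
    sumN (suc n) (λ t → f (n ∸ t))      ∎

  sumN-telescope : ∀ n {f g u : ℕ → Carrier} → (∀ t → f t + u t ≈ g t + u (suc t)) →
                   sumN n f + u 0 ≈ sumN n g + u n
  sumN-telescope zero    step = refl
  sumN-telescope (suc n) {f} {g} {u} step = begin
    (sumN n f + f n) + u 0       ≈⟨ +-xy∙z≈xz∙y _ _ _ ⟩
    (sumN n f + u 0) + f n       ≈⟨ +-congʳ (sumN-telescope n step) ⟩
    (sumN n g + u n) + f n       ≈⟨ +-assoc _ _ _ ⟩
    sumN n g + (u n + f n)       ≈⟨ +-congˡ (trans (+-comm _ _) (step n)) ⟩
    sumN n g + (g n + u (suc n)) ≈⟨ +-assoc _ _ _ ⟨
    (sumN n g + g n) + u (suc n) ∎

  sumN-pairing-shift : ∀ n {x} {P P′ Q Q′ : ℕ → Carrier} →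
                       (∀ t → P (suc t) ≈ P′ t + x * P t) →
                       (∀ t → Q′ t ≈ Q (suc t) + x * Q′ (suc t)) →
                       P 0 * Q′ 0 ≈ 0# → P n * Q′ n ≈ 0# →
                       sumN n (λ t → P′ t * Q′ t) ≈ sumN n (λ t → P (suc t) * Q (suc t))
  sumN-pairing-shift n {x} {P} {P′} {Q} {Q′} P-rec Q′-rec first last = begin
    sumN n (λ t → P′ t * Q′ t)                ≈⟨ +-identityʳ _ ⟨
    sumN n (λ t → P′ t * Q′ t) + 0#           ≈⟨ +-congˡ (u≈0 first) ⟨
    sumN n (λ t → P′ t * Q′ t) + u 0          ≈⟨ sumN-telescope n step ⟩
    sumN n (λ t → P (suc t) * Q (suc t)) + u n ≈⟨ +-congˡ (u≈0 last) ⟩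
    sumN n (λ t → P (suc t) * Q (suc t)) + 0#  ≈⟨ +-identityʳ _ ⟩
    sumN n (λ t → P (suc t) * Q (suc t))       ∎
    where
    u : ℕ → Carrier
    u t = x * (P t * Q′ t)
    u≈0 : ∀ {t} → P t * Q′ t ≈ 0# → u t ≈ 0#
    u≈0 PQ′≈0 = trans (*-congˡ PQ′≈0) (zeroʳ x)
    step : ∀ t → P′ t * Q′ t + u t ≈ P (suc t) * Q (suc t) + u (suc t)
    step t = begin
      P′ t * Q′ t + x * (P t * Q′ t)             ≈⟨ +-congˡ (*-assoc _ _ _) ⟨
      P′ t * Q′ t + x * P t * Q′ t               ≈⟨ distribʳ _ _ _ ⟨
      (P′ t + x * P t) * Q′ t                    ≈⟨ *-cong (P-rec t) (sym (Q′-rec t)) ⟨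
      P (suc t) * (Q (suc t) + x * Q′ (suc t))   ≈⟨ distribˡ _ _ _ ⟩
      P (suc t) * Q (suc t) + P (suc t) * (x * Q′ (suc t)) ≈⟨ +-congˡ (x∙yz≈y∙xz _ _ _) ⟩
      P (suc t) * Q (suc t) + u (suc t)          ∎

  HasSum-cong : ∀ {f g : ℤ → Carrier} {s t} → (∀ i → f i ≈ g i) → s ≈ t → HasSum f s → HasSum g t
  HasSum-cong f≈g s≈t (L , n , outside , sum) =
    L , n , (λ i i∉ → trans (sym (f≈g i)) (outside i i∉)) ,
    trans (sym (sumN-cong n (λ _ → f≈g _))) (trans sum s≈t)

  HasSum-*ˡ : ∀ x {f : ℤ → Carrier} {s} → HasSum f s → HasSum (λ i → x * f i) (x * s)
  HasSum-*ˡ x (L , n , outside , sum) =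
    L , n , (λ i i∉ → trans (*-congˡ (outside i i∉)) (zeroʳ x)) , trans (sumN-*ˡ n x _) (*-congˡ sum)

  HasSum-reflect : ∀ {f : ℤ → Carrier} {s} → HasSum f s → HasSum (λ i → f (ℤ.- i)) s
  HasSum-reflect {f} {s} (L , n , outside , sum) = L′ , n , outside′ , sum′
    where
    L′ : ℤ
    L′ = ℤ.suc (ℤ.- (L ℤ.+ + n))
    end′ : L′ ℤ.+ + n ≡ ℤ.suc (ℤ.- L)
    end′ = lemma L (+ n)
      where
      lemma : ∀ L x → (1ℤ ℤ.+ ℤ.- (L ℤ.+ x)) ℤ.+ x ≡ 1ℤ ℤ.+ ℤ.- L
      lemma = ℤ-Solver.solve-∀
    outside′ : ∀ i → i ℤ.< L′ ⊎ L′ ℤ.+ + n ℤ.≤ i → f (ℤ.- i) ≈ 0#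
    outside′ i (inj₁ i<L′) =
      outside (ℤ.- i) (inj₂ (≡.subst (ℤ._≤ ℤ.- i) (ℤ.neg-involutive _) (ℤ.neg-mono-≤ i≤)))
      where
      i≤ : i ℤ.≤ ℤ.- (L ℤ.+ + n)
      i≤ = ≡.subst (i ℤ.≤_) (ℤ.pred-suc _) (ℤ.i<j⇒i≤pred[j] i<L′)
    outside′ i (inj₂ L′+n≤i) =
      outside (ℤ.- i) (inj₁ (≡.subst (ℤ.- i ℤ.<_) (ℤ.neg-involutive L) (ℤ.neg-mono-< -L<i)))
      where
      -L<i : ℤ.- L ℤ.< i
      -L<i = ℤ.suc[i]≤j⇒i<j (≡.subst (ℤ._≤ i) end′ L′+n≤i)
    sum′ : sumN n (λ t → f (ℤ.- (L′ ℤ.+ + t))) ≈ s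
    sum′ = begin
      sumN n (λ t → f (ℤ.- (L′ ℤ.+ + t)))           ≈⟨ sumN-reverse n _ ⟩
      sumN n (λ t → f (ℤ.- (L′ ℤ.+ + (n ∸ suc t)))) ≈⟨ sumN-cong n (λ t<n → reflexive (≡.cong f (mirror t<n))) ⟩
      sumN n (λ t → f (L ℤ.+ + t))                  ≈⟨ sum ⟩
      s                                             ∎
      where
      mirror : ∀ {t} → t ℕ.< n → ℤ.- (L′ ℤ.+ + (n ∸ suc t)) ≡ L ℤ.+ + t
      mirror {t} t<n = ≡.trans (≡.cong (λ k → ℤ.- (ℤ.suc (ℤ.- (L ℤ.+ k)) ℤ.+ + e)) n≡) (lemma L (+ t) (+ e))
        where
        e : ℕ
        e = n ∸ suc t
        n≡ : + n ≡ + suc t ℤ.+ + e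
        n≡ = ≡.trans (≡.cong +_ (≡.sym (ℕ.m+[n∸m]≡n t<n))) (ℤ.pos-+ (suc t) e)
        lemma : ∀ L x y → ℤ.- ((1ℤ ℤ.+ ℤ.- (L ℤ.+ ((1ℤ ℤ.+ x) ℤ.+ y))) ℤ.+ y) ≡ L ℤ.+ x
        lemma = ℤ-Solver.solve-∀

  binomialCoeff : Carrier → ℕ → ℕ → Carrier
  binomialCoeff x N k = nat (N C k) * pow x (N ∸ k)

  binomialCoeff-above : ∀ x {N k} → N ℕ.< k → binomialCoeff x N k ≈ 0#
  binomialCoeff-above x N<k = trans (*-congʳ (reflexive (≡.cong nat (k>n⇒nCk≡0 N<k)))) (zeroˡ _)

  binomialCoeff-diag : ∀ x N → binomialCoeff x N N ≈ 1#
  binomialCoeff-diag x N = begin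
    nat (N C N) * pow x (N ∸ N) ≡⟨ ≡.cong₂ (λ c e → nat c * pow x e) (nCn≡1 N) (ℕ.n∸n≡0 N) ⟩
    (1# + 0#) * 1#              ≈⟨ *-identityʳ _ ⟩
    1# + 0#                     ≈⟨ +-identityʳ 1# ⟩
    1#                          ∎

  binomialCoeff-suc-zero : ∀ x N → binomialCoeff x (suc N) 0 ≈ x * binomialCoeff x N 0
  binomialCoeff-suc-zero x N = x∙yz≈y∙xz _ _ _

  binomialCoeff-pascal : ∀ x N k →
    binomialCoeff x (suc N) (suc k) ≈ binomialCoeff x N k + x * binomialCoeff x N (suc k)
  binomialCoeff-pascal x N k = begin
    nat (suc N C suc k) * pow x (N ∸ k)                    ≡⟨ ≡.cong (λ c → nat c * pow x (N ∸ k)) (nCk+nC[k+1]≡[n+1]C[k+1] N k) ⟨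
    nat (N C k ℕ.+ N C suc k) * pow x (N ∸ k)              ≈⟨ *-congʳ (nat-+ (N C k) (N C suc k)) ⟩
    (nat (N C k) + nat (N C suc k)) * pow x (N ∸ k)        ≈⟨ distribʳ _ _ _ ⟩
    binomialCoeff x N k + nat (N C suc k) * pow x (N ∸ k)  ≈⟨ +-congˡ lower ⟩
    binomialCoeff x N k + x * binomialCoeff x N (suc k)    ∎
    where
    lower : nat (N C suc k) * pow x (N ∸ k) ≈ x * binomialCoeff x N (suc k)
    lower with k ℕ.<? N
    ... | yes k<N = trans (*-congˡ (reflexive (≡.cong (pow x) (ℕ.+-∸-assoc 1 k<N)))) (x∙yz≈y∙xz _ _ _)
    ... | no k≮N  = trans (*-congʳ C≈0) (trans (zeroˡ _) (sym (trans (*-congˡ (binomialCoeff-above x N<k+1)) (zeroʳ x))))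
      where
      N<k+1 : N ℕ.< suc k
      N<k+1 = ℕ.s≤s (ℕ.≮⇒≥ k≮N)
      C≈0 : nat (N C suc k) ≈ 0#
      C≈0 = reflexive (≡.cong nat (k>n⇒nCk≡0 N<k+1))

  cond≈binomialCoeff : ∀ k N → cond k N ≈ binomialCoeff b N k
  cond≈binomialCoeff k N with k ℕ.≤? N
  ... | yes _   = refl
  ... | no k≰N = sym (binomialCoeff-above b (ℕ.≰⇒> k≰N))

  condNeg≈binomialCoeff : ∀ K J → condNeg K J ≈ binomialCoeff (- b) K J
  condNeg≈binomialCoeff K J with J ℕ.≤? K
  ... | no J≰K  = sym (binomialCoeff-above (- b) (ℕ.≰⇒> J≰K))
  ... | yes J≤K = begin
    sgn (K ∸ J) * nat (K C (K ∸ J)) * pow b (K ∸ J)   ≈⟨ *-congʳ (*-comm _ _) ⟩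
    nat (K C (K ∸ J)) * sgn (K ∸ J) * pow b (K ∸ J)   ≈⟨ *-assoc _ _ _ ⟩
    nat (K C (K ∸ J)) * (sgn (K ∸ J) * pow b (K ∸ J)) ≈⟨ *-cong (reflexive (≡.cong nat (≡.sym (nCk≡nC[n∸k] J≤K)))) (sgn*pow≈pow-neg b (K ∸ J)) ⟩
    nat (K C J) * pow (- b) (K ∸ J)                   ∎

  phiP-below : ∀ {K j} → j ℤ.< K → phiP K j ≈ 0#
  phiP-below {+ K}      {+ J}      (ℤ.+<+ J<K) = trans (cond≈binomialCoeff K J) (binomialCoeff-above b J<K)
  phiP-below {+ K}      { -[1+ n ]} _          = refl
  phiP-below { -[1+ k ]} { -[1+ n ]} (ℤ.-<- k<n) = trans (condNeg≈binomialCoeff k n) (binomialCoeff-above (- b) k<n)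

  phiP-negative : ∀ {K} J → K ℤ.< 0ℤ → phiP K (+ J) ≈ 0#
  phiP-negative { -[1+ k ]} J _ = refl
  phiP-negative {+ k}       J (ℤ.+<+ ())

  phiP-diag : ∀ K → phiP K K ≈ 1#
  phiP-diag (+ K)     = trans (cond≈binomialCoeff K K) (binomialCoeff-diag b K)
  phiP-diag -[1+ k ]  = trans (condNeg≈binomialCoeff k k) (binomialCoeff-diag (- b) k)

  phiP-pascal : ∀ K j → phiP K (ℤ.suc j) ≈ phiP (ℤ.pred K) j + b * phiP K j
  phiP-pascal (+ zero)  (+ J) = begin
    cond 0 (suc J)             ≈⟨ cond≈binomialCoeff 0 (suc J) ⟩
    binomialCoeff b (suc J) 0  ≈⟨ binomialCoeff-suc-zero b J ⟩
    b * binomialCoeff b J 0    ≈⟨ *-congˡ (cond≈binomialCoeff 0 J) ⟨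
    b * cond 0 J               ≈⟨ +-identityˡ _ ⟨
    0# + b * cond 0 J          ∎
  phiP-pascal (+ suc k) (+ J) = begin
    cond (suc k) (suc J)                                         ≈⟨ cond≈binomialCoeff (suc k) (suc J) ⟩
    binomialCoeff b (suc J) (suc k)                              ≈⟨ binomialCoeff-pascal b J k ⟩
    binomialCoeff b J k + b * binomialCoeff b J (suc k)          ≈⟨ +-cong (cond≈binomialCoeff k J) (*-congˡ (cond≈binomialCoeff (suc k) J)) ⟨
    cond k J + b * cond (suc k) J                                ∎
  phiP-pascal (+ zero)  -[1+ zero ]  = trans (phiP-diag 0ℤ) (sym (trans (+-*-zeroʳ _ b) (phiP-diag -1ℤ)))
  phiP-pascal (+ suc k) -[1+ zero ]  = sym (+-*-zeroʳ 0# b)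
  phiP-pascal (+ zero)  -[1+ suc n ] = sym (+-*-zeroʳ 0# b)
  phiP-pascal (+ suc k) -[1+ suc n ] = sym (+-*-zeroʳ 0# b)
  phiP-pascal -[1+ k ]  (+ J)        = sym (+-*-zeroʳ 0# b)
  phiP-pascal -[1+ k ]  -[1+ zero ]  = sym (begin
    condNeg (suc k) 0 + b * condNeg k 0                          ≈⟨ +-cong (condNeg≈binomialCoeff (suc k) 0) (*-congˡ (condNeg≈binomialCoeff k 0)) ⟩
    binomialCoeff (- b) (suc k) 0 + b * binomialCoeff (- b) k 0 ≈⟨ +-congʳ (binomialCoeff-suc-zero (- b) k) ⟩
    - b * binomialCoeff (- b) k 0 + b * binomialCoeff (- b) k 0 ≈⟨ neg-*-cancel b _ ⟩
    0#                                                           ∎)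
  phiP-pascal -[1+ k ]  -[1+ suc n ] = begin
    condNeg k n                                                          ≈⟨ condNeg≈binomialCoeff k n ⟩
    B                                                                    ≈⟨ +-identityʳ B ⟨
    B + 0#                                                               ≈⟨ +-congˡ (neg-*-cancel b C) ⟨
    B + (- b * C + b * C)                                                ≈⟨ +-assoc _ _ _ ⟨
    (B + - b * C) + b * C                                                ≈⟨ +-congʳ (binomialCoeff-pascal (- b) k n) ⟨
    binomialCoeff (- b) (suc k) (suc n) + b * C                          ≈⟨ +-cong (condNeg≈binomialCoeff (suc k) (suc n)) (*-congˡ (condNeg≈binomialCoeff k (suc n))) ⟨
    condNeg (suc k) (suc n) + b * condNeg k (suc n)                      ∎
    where
    B C : Carrier
    B = binomialCoeff (- b) k n
    C = binomialCoeff (- b) k (suc n)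

  phiB-mirror : ∀ n j → phiB n j ≡ phiP (ℤ.- n) (ℤ.- j)
  phiB-mirror (+ zero)  (+ zero)   = ≡.refl
  phiB-mirror (+ zero)  (+ suc J)  = ≡.refl
  phiB-mirror (+ zero)  -[1+ n ]   = ≡.refl
  phiB-mirror (+ suc K) (+ zero)   = ≡.refl
  phiB-mirror (+ suc K) (+ suc J)  = ≡.refl
  phiB-mirror (+ suc K) -[1+ n ]   = ≡.refl
  phiB-mirror -[1+ k ]  (+ zero)   = ≡.refl
  phiB-mirror -[1+ k ]  (+ suc J)  = ≡.refl
  phiB-mirror -[1+ k ]  -[1+ n ]   = ≡.refl

  phiB-above : ∀ {n j} → n ℤ.< j → phiB n j ≈ 0#
  phiB-above {n} {j} n<j = trans (reflexive (phiB-mirror n j)) (phiP-below (ℤ.neg-mono-< n<j))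

  phiB-diag : ∀ n → phiB n n ≈ 1#
  phiB-diag n = trans (reflexive (phiB-mirror n n)) (phiP-diag (ℤ.- n))

  phiB-one-nonpositive : ∀ {j} → j ℤ.≤ 0ℤ → phiB 1ℤ j ≈ 0#
  phiB-one-nonpositive {+ zero}    _ = refl
  phiB-one-nonpositive { -[1+ n ]} _ = refl
  phiB-one-nonpositive {+ suc n}   (ℤ.+≤+ ())

  phiB-pascal : ∀ n j → phiB (ℤ.pred n) j ≈ phiB n (ℤ.suc j) + b * phiB (ℤ.pred n) (ℤ.suc j)
  phiB-pascal n j = begin
    phiB (ℤ.pred n) j
      ≡⟨ ≡.trans (phiB-mirror (ℤ.pred n) j) (≡.cong₂ phiP (neg-pred n) (neg-as-suc j)) ⟩
    phiP (ℤ.suc (ℤ.- n)) (ℤ.suc j′)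
      ≈⟨ phiP-pascal (ℤ.suc (ℤ.- n)) j′ ⟩
    phiP (ℤ.pred (ℤ.suc (ℤ.- n))) j′ + b * phiP (ℤ.suc (ℤ.- n)) j′
      ≡⟨ ≡.cong₂ (λ K K′ → phiP K j′ + b * phiP K′ j′) (ℤ.pred-suc (ℤ.- n)) (≡.sym (neg-pred n)) ⟩
    phiP (ℤ.- n) j′ + b * phiP (ℤ.- ℤ.pred n) j′
      ≡⟨ ≡.cong₂ (λ x y → x + b * y) (phiB-mirror n (ℤ.suc j)) (phiB-mirror (ℤ.pred n) (ℤ.suc j)) ⟨
    phiB n (ℤ.suc j) + b * phiB (ℤ.pred n) (ℤ.suc j)
      ∎
    where
    j′ : ℤ
    j′ = ℤ.- ℤ.suc j
    neg-pred : ∀ n → ℤ.- (-1ℤ ℤ.+ n) ≡ 1ℤ ℤ.+ ℤ.- n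
    neg-pred = ℤ-Solver.solve-∀
    neg-as-suc : ∀ j → ℤ.- j ≡ 1ℤ ℤ.+ ℤ.- (1ℤ ℤ.+ j)
    neg-as-suc = ℤ-Solver.solve-∀

  PhiP-summand : ℤ → ℤ → ℕ → Carrier
  PhiP-summand m j k = half * pow (- b) k * phiP (m ℤ.+ + k) j

  PhiP-as-sumN : ∀ m j {N} → ∣ j ℤ.- m ∣ ℕ.< N → PhiP m j ≈ sumN N (PhiP-summand m j)
  PhiP-as-sumN m j {N} D<N = begin
    sumN (suc D) F                 ≈⟨ sumN-extend (N ∸ suc D) vanish ⟨
    sumN ((N ∸ suc D) ℕ.+ suc D) F ≡⟨ ≡.cong (λ n → sumN n F) (ℕ.m∸n+n≡m D<N) ⟩
    sumN N F                       ∎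
    where
    D : ℕ
    D = ∣ j ℤ.- m ∣
    F : ℕ → Carrier
    F = PhiP-summand m j
    vanish : ∀ {k} → suc D ℕ.≤ k → F k ≈ 0#
    vanish D<k = trans (*-congˡ (phiP-below (∣j-m∣<k⇒j<m+k {j} {m} D<k))) (zeroʳ _)

  PhiP-below : ∀ {m j} → j ℤ.< m → PhiP m j ≈ 0#
  PhiP-below {m} {j} j<m = sumN-vanishes (suc ∣ j ℤ.- m ∣) λ {k} _ →
    trans (*-congˡ (phiP-below (ℤ.<-≤-trans j<m (ℤ.i≤i+j m (+ k))))) (zeroʳ _)

  PhiP-diag : ∀ m → PhiP m m ≈ half
  PhiP-diag m = begin
    PhiP m m                           ≈⟨ PhiP-as-sumN m m (ℕ.s≤s (ℕ.≤-reflexive (≡.cong ∣_∣ (ℤ.+-inverseʳ m)))) ⟩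
    0# + half * 1# * phiP (m ℤ.+ + 0) m ≈⟨ +-identityˡ _ ⟩
    half * 1# * phiP (m ℤ.+ + 0) m      ≡⟨ ≡.cong (λ K → half * 1# * phiP K m) (ℤ.+-identityʳ m) ⟩
    half * 1# * phiP m m                ≈⟨ *-cong (*-identityʳ half) (phiP-diag m) ⟩
    half * 1#                           ≈⟨ *-identityʳ half ⟩
    half                                ∎

  PhiP-pascal : ∀ m j → PhiP m (ℤ.suc j) ≈ PhiP (ℤ.pred m) j + b * PhiP m j
  PhiP-pascal m j = begin
    PhiP m (ℤ.suc j)
      ≈⟨ PhiP-as-sumN m (ℤ.suc j) {N} (≡.subst (λ i → ∣ i ∣ ℕ.< N) (suc-j-m j m) bound) ⟩
    sumN N (PhiP-summand m (ℤ.suc j))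
      ≈⟨ sumN-cong N (λ {k} _ → summand-pascal k) ⟩
    sumN N (λ k → PhiP-summand (ℤ.pred m) j k + b * PhiP-summand m j k)
      ≈⟨ sumN-+ N _ _ ⟩
    sumN N (PhiP-summand (ℤ.pred m) j) + sumN N (λ k → b * PhiP-summand m j k)
      ≈⟨ +-congˡ (sumN-*ˡ N b _) ⟩
    sumN N (PhiP-summand (ℤ.pred m) j) + b * sumN N (PhiP-summand m j)
      ≈⟨ +-cong (PhiP-as-sumN (ℤ.pred m) j {N} (≡.subst (λ i → ∣ i ∣ ℕ.< N) (j-pred-m j m) bound))
                (*-congˡ (PhiP-as-sumN m j {N} (ℕ.m<n⇒m<1+n (ℕ.n<1+n _)))) ⟨
    PhiP (ℤ.pred m) j + b * PhiP m j
      ∎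
    where
    N : ℕ
    N = suc (suc ∣ j ℤ.- m ∣)
    bound : ∣ 1ℤ ℤ.+ (j ℤ.- m) ∣ ℕ.< N
    bound = ℕ.s≤s (ℤ.∣i+j∣≤∣i∣+∣j∣ 1ℤ (j ℤ.- m))
    suc-j-m : ∀ j m → 1ℤ ℤ.+ (j ℤ.- m) ≡ (1ℤ ℤ.+ j) ℤ.- m
    suc-j-m = ℤ-Solver.solve-∀
    j-pred-m : ∀ j m → 1ℤ ℤ.+ (j ℤ.- m) ≡ j ℤ.- (-1ℤ ℤ.+ m)
    j-pred-m = ℤ-Solver.solve-∀
    summand-pascal : ∀ k → PhiP-summand m (ℤ.suc j) k ≈ PhiP-summand (ℤ.pred m) j k + b * PhiP-summand m j k
    summand-pascal k = begin
      w * phiP (m ℤ.+ + k) (ℤ.suc j)                                       ≈⟨ *-congˡ (phiP-pascal (m ℤ.+ + k) j) ⟩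
      w * (phiP (ℤ.pred (m ℤ.+ + k)) j + b * phiP (m ℤ.+ + k) j)           ≈⟨ distribˡ _ _ _ ⟩
      w * phiP (ℤ.pred (m ℤ.+ + k)) j + w * (b * phiP (m ℤ.+ + k) j)       ≡⟨ ≡.cong (λ K → w * phiP K j + w * (b * phiP (m ℤ.+ + k) j)) (ℤ.pred-+ m (+ k)) ⟨
      w * phiP (ℤ.pred m ℤ.+ + k) j + w * (b * phiP (m ℤ.+ + k) j)         ≈⟨ +-congˡ (x∙yz≈y∙xz _ _ _) ⟩
      PhiP-summand (ℤ.pred m) j k + b * PhiP-summand m j k                  ∎
      where
      w : Carrier
      w = half * pow (- b) k

  PhiP-nonpositive-at-one : ∀ r → PhiP (ℤ.- + r) 1ℤ ≈ 0#
  PhiP-nonpositive-at-one r = begin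
    PhiP m₀ 1ℤ                                        ≈⟨ PhiP-as-sumN m₀ 1ℤ (ℕ.s≤s (ℕ.≤-reflexive width)) ⟩
    sumN r F + F r + F (suc r)                        ≈⟨ +-cong (+-cong (sumN-vanishes r early) (*-congˡ at-r)) (*-congˡ at-suc-r) ⟩
    0# + half * p * b + half * (- b * p) * 1#         ≈⟨ +-cong (+-identityˡ _) (*-identityʳ _) ⟩
    half * p * b + half * (- b * p)                   ≈⟨ +-congˡ opposite ⟩
    half * p * b + - (half * p * b)                   ≈⟨ -‿inverseʳ _ ⟩
    0#                                                ∎
    where
    m₀ : ℤ
    m₀ = ℤ.- + r
    F : ℕ → Carrier
    F = PhiP-summand m₀ 1ℤ
    p : Carrier
    p = pow (- b) r
    width : ∣ 1ℤ ℤ.- m₀ ∣ ≡ suc r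
    width = ≡.cong ∣_∣ (lemma (+ r))
      where
      lemma : ∀ x → 1ℤ ℤ.- ℤ.- x ≡ 1ℤ ℤ.+ x
      lemma = ℤ-Solver.solve-∀
    early : ∀ {t} → t ℕ.< r → F t ≈ 0#
    early {t} t<r = trans (*-congˡ (phiP-negative {m₀ ℤ.+ + t} 1 m₀+t<0)) (zeroʳ _)
      where
      m₀+t<0 : m₀ ℤ.+ + t ℤ.< 0ℤ
      m₀+t<0 = ≡.subst (m₀ ℤ.+ + t ℤ.<_) (ℤ.+-inverseˡ (+ r)) (ℤ.+-monoʳ-< m₀ (ℤ.+<+ t<r))
    at-r : phiP (m₀ ℤ.+ + r) 1ℤ ≈ b
    at-r = begin
      phiP (m₀ ℤ.+ + r) 1ℤ    ≡⟨ ≡.cong (λ K → phiP K 1ℤ) (ℤ.+-inverseˡ (+ r)) ⟩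
      cond 0 1                ≈⟨ cond≈binomialCoeff 0 1 ⟩
      (1# + 0#) * (b * 1#)    ≈⟨ *-cong (+-identityʳ 1#) (*-identityʳ b) ⟩
      1# * b                  ≈⟨ *-identityˡ b ⟩
      b                       ∎
    at-suc-r : phiP (m₀ ℤ.+ + suc r) 1ℤ ≈ 1#
    at-suc-r = trans (reflexive (≡.cong (λ K → phiP K 1ℤ) (-i+[1+i]≡1 (+ r)))) (phiP-diag 1ℤ)
    opposite : half * (- b * p) ≈ - (half * p * b)
    opposite = begin
      half * (- b * p)   ≈⟨ *-congˡ (-‿distribˡ-* b p) ⟨
      half * - (b * p)   ≈⟨ -‿distribʳ-* half (b * p) ⟨
      - (half * (b * p)) ≈⟨ -‿cong (trans (*-congˡ (*-comm b p)) (sym (*-assoc half p b))) ⟩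
      - (half * p * b)   ∎

  PhiB-mirror : ∀ m j → PhiB m j ≈ PhiP (ℤ.- m) (ℤ.- j)
  PhiB-mirror m j = begin
    PhiB m j
      ≈⟨ sumN-cong (suc ∣ m ℤ.- j ∣) (λ {k} _ → reflexive (≡.cong (half * pow (- b) k *_) (mirror k))) ⟩
    sumN (suc ∣ m ℤ.- j ∣) (PhiP-summand (ℤ.- m) (ℤ.- j))
      ≡⟨ ≡.cong (λ i → sumN (suc ∣ i ∣) (PhiP-summand (ℤ.- m) (ℤ.- j))) (flip m j) ⟩
    PhiP (ℤ.- m) (ℤ.- j)
      ∎
    where
    flip : ∀ m j → m ℤ.- j ≡ ℤ.- j ℤ.- ℤ.- m
    flip = ℤ-Solver.solve-∀
    neg-minus : ∀ m x → ℤ.- (m ℤ.- x) ≡ ℤ.- m ℤ.+ x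
    neg-minus = ℤ-Solver.solve-∀
    mirror : ∀ k → phiB (m ℤ.- + k) j ≡ phiP (ℤ.- m ℤ.+ + k) (ℤ.- j)
    mirror k = ≡.trans (phiB-mirror (m ℤ.- + k) j) (≡.cong (λ K → phiP K (ℤ.- j)) (neg-minus m (+ k)))

  δ-≡ : ∀ {m n} → m ≡ n → δ m n ≈ 1#
  δ-≡ {m} {n} m≡n with m ℤ.≟ n
  ... | yes _   = refl
  ... | no m≢n = contradiction m≡n m≢n

  δ-≢ : ∀ {m n} → m ≢ n → δ m n ≈ 0#
  δ-≢ {m} {n} m≢n with m ℤ.≟ n
  ... | yes m≡n = contradiction m≡n m≢n
  ... | no _    = refl

  δ-neg : ∀ m n → δ (ℤ.- m) (ℤ.- n) ≈ δ m n
  δ-neg m n with m ℤ.≟ n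
  ... | yes m≡n = δ-≡ (≡.cong ℤ.-_ m≡n)
  ... | no m≢n  = δ-≢ (λ -m≡-n → m≢n (ℤ.neg-injective -m≡-n))

  pairing-outside-window : ∀ {m n len} → n ℤ.< m ℤ.+ + len →
                           ∀ j → j ℤ.< m ⊎ m ℤ.+ + len ℤ.≤ j → PhiP m j * phiB n j ≈ 0#
  pairing-outside-window n<end j (inj₁ j<m)   = trans (*-congʳ (PhiP-below j<m)) (zeroˡ _)
  pairing-outside-window n<end j (inj₂ end≤j) = trans (*-congˡ (phiB-above (ℤ.<-≤-trans n<end end≤j))) (zeroʳ _)

  pairingWindow : ℤ → ℕ → Carrier
  pairingWindow m d = sumRange m (suc d) (λ j → PhiP m j * phiB (m ℤ.+ + d) j)

  pairingWindow-pred : ∀ m d → pairingWindow (ℤ.pred m) d ≈ pairingWindow m d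
  pairingWindow-pred m d = begin
    sumN (suc d) (λ t → P′ t * Q′ t)
      ≈⟨ sumN-pairing-shift (suc d) {b} {P} {P′} {Q} {Q′} P-rec Q′-rec first last ⟩
    sumN (suc d) (λ t → P (suc t) * Q (suc t))
      ≈⟨ sumN-cong (suc d) (λ {t} _ → reflexive (≡.cong (λ j → PhiP m j * phiB n j) (pred-shift m (+ t)))) ⟩
    pairingWindow m d
      ∎
    where
    L n : ℤ
    L = ℤ.pred m
    n = m ℤ.+ + d
    P P′ Q Q′ : ℕ → Carrier
    P t = PhiP m (L ℤ.+ + t)
    P′ t = PhiP L (L ℤ.+ + t)
    Q t = phiB n (L ℤ.+ + t)
    Q′ t = phiB (L ℤ.+ + d) (L ℤ.+ + t)
    pred-shift : ∀ m x → (-1ℤ ℤ.+ m) ℤ.+ (1ℤ ℤ.+ x) ≡ m ℤ.+ x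
    pred-shift = ℤ-Solver.solve-∀
    +-suc : ∀ i x → i ℤ.+ (1ℤ ℤ.+ x) ≡ 1ℤ ℤ.+ (i ℤ.+ x)
    +-suc = ℤ-Solver.solve-∀
    P-rec : ∀ t → P (suc t) ≈ P′ t + b * P t
    P-rec t = trans (reflexive (≡.cong (PhiP m) (+-suc L (+ t)))) (PhiP-pascal m (L ℤ.+ + t))
    Q′-rec : ∀ t → Q′ t ≈ Q (suc t) + b * Q′ (suc t)
    Q′-rec t = begin
      phiB (L ℤ.+ + d) (L ℤ.+ + t)
        ≡⟨ ≡.cong (λ K → phiB K (L ℤ.+ + t)) (ℤ.pred-+ m (+ d)) ⟩
      phiB (ℤ.pred n) (L ℤ.+ + t)
        ≈⟨ phiB-pascal n (L ℤ.+ + t) ⟩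
      phiB n (ℤ.suc (L ℤ.+ + t)) + b * phiB (ℤ.pred n) (ℤ.suc (L ℤ.+ + t))
        ≡⟨ ≡.cong₂ (λ K j → phiB n j + b * phiB K j) (ℤ.pred-+ m (+ d)) (+-suc L (+ t)) ⟨
      Q (suc t) + b * Q′ (suc t)
        ∎
    first : P 0 * Q′ 0 ≈ 0#
    first = trans (*-congʳ (PhiP-below L+0<m)) (zeroˡ _)
      where
      L+0<m : L ℤ.+ + 0 ℤ.< m
      L+0<m = ≡.subst (ℤ._< m) (≡.sym (ℤ.+-identityʳ L)) (ℤ.i≤pred[j]⇒i<j ℤ.≤-refl)
    last : P (suc d) * Q′ (suc d) ≈ 0#
    last = trans (*-congˡ (phiB-above (ℤ.+-monoʳ-< L (ℤ.+<+ (ℕ.n<1+n d))))) (zeroʳ _)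

  pairingWindow-constant : ∀ m m′ d → pairingWindow m d ≈ pairingWindow m′ d
  pairingWindow-constant m m′ d =
    pred-invariant⇒constant setoid (λ m → pairingWindow m d) (λ m → pairingWindow-pred m d) m m′

  pairingWindow-diag : ∀ m → pairingWindow m 0 ≈ half
  pairingWindow-diag m = begin
    0# + PhiP m (m ℤ.+ + 0) * phiB (m ℤ.+ + 0) (m ℤ.+ + 0) ≈⟨ +-identityˡ _ ⟩
    PhiP m (m ℤ.+ + 0) * phiB (m ℤ.+ + 0) (m ℤ.+ + 0)      ≡⟨ ≡.cong (λ j → PhiP m j * phiB j j) (ℤ.+-identityʳ m) ⟩
    PhiP m m * phiB m m                                    ≈⟨ *-cong (PhiP-diag m) (phiB-diag m) ⟩
    half * 1#                                              ≈⟨ *-identityʳ half ⟩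
    half                                                   ∎

  pairingWindow-off-diag : ∀ m r → pairingWindow m (suc r) ≈ 0#
  pairingWindow-off-diag m r = begin
    pairingWindow m (suc r)     ≈⟨ pairingWindow-constant m m₀ (suc r) ⟩
    sumN (suc r) G + G (suc r)  ≈⟨ +-cong (sumN-vanishes (suc r) early) last ⟩
    0# + 0#                     ≈⟨ +-identityˡ 0# ⟩
    0#                          ∎
    where
    m₀ : ℤ
    m₀ = ℤ.- + r
    top : m₀ ℤ.+ + suc r ≡ 1ℤ
    top = -i+[1+i]≡1 (+ r)
    G : ℕ → Carrier
    G t = PhiP m₀ (m₀ ℤ.+ + t) * phiB (m₀ ℤ.+ + suc r) (m₀ ℤ.+ + t)
    early : ∀ {t} → t ℕ.< suc r → G t ≈ 0#
    early {t} (ℕ.s≤s t≤r) =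
      trans (*-congˡ (trans (reflexive (≡.cong (λ n → phiB n (m₀ ℤ.+ + t)) top)) (phiB-one-nonpositive m₀+t≤0))) (zeroʳ _)
      where
      m₀+t≤0 : m₀ ℤ.+ + t ℤ.≤ 0ℤ
      m₀+t≤0 = ≡.subst (m₀ ℤ.+ + t ℤ.≤_) (ℤ.+-inverseˡ (+ r)) (ℤ.+-monoʳ-≤ m₀ (ℤ.+≤+ t≤r))
    last : G (suc r) ≈ 0#
    last = begin
      G (suc r)                 ≡⟨ ≡.cong (λ j → PhiP m₀ j * phiB j j) top ⟩
      PhiP m₀ 1ℤ * phiB 1ℤ 1ℤ   ≈⟨ *-congʳ (PhiP-nonpositive-at-one r) ⟩
      0# * phiB 1ℤ 1ℤ           ≈⟨ zeroˡ _ ⟩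
      0#                        ∎

  pairing-HasSum : ∀ m n → HasSum (λ j → PhiP m j * phiB n j) (half * δ m n)
  pairing-HasSum m n with offset m n
  ... | below k = m , 0 , pairing-outside-window n<m , sym (trans (*-congˡ (δ-≢ m≢n)) (zeroʳ half))
    where
    n<m : m ℤ.+ -[1+ k ] ℤ.< m ℤ.+ + 0
    n<m = ℤ.+-monoʳ-< m ℤ.-<+
    m≢n : m ≢ m ℤ.+ -[1+ k ]
    m≢n eq = ℤ.<⇒≢ n<m (≡.trans (≡.sym eq) (≡.sym (ℤ.+-identityʳ m)))
  ... | above zero = m , 1 , pairing-outside-window (ℤ.+-monoʳ-< m (ℤ.+<+ (ℕ.n<1+n 0))) ,
    trans (pairingWindow-diag m) (sym (trans (*-congˡ (δ-≡ (≡.sym (ℤ.+-identityʳ m)))) (*-identityʳ half)))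
  ... | above (suc r) = m , suc (suc r) , pairing-outside-window (ℤ.+-monoʳ-< m (ℤ.+<+ (ℕ.n<1+n (suc r)))) ,
    trans (pairingWindow-off-diag m r) (sym (trans (*-congˡ (δ-≢ m≢n)) (zeroʳ half)))
    where
    m≢n : m ≢ m ℤ.+ + suc r
    m≢n eq = ℤ.<⇒≢ (ℤ.+-monoʳ-< m (ℤ.+<+ (ℕ.s≤s ℕ.z≤n))) (≡.trans (ℤ.+-identityʳ m) eq)

  anticommTerm-star : ∀ (x y : Lin) i → anticommTerm (star x) y i ≈ (1# + 1#) * (x (ℤ.- i) * y (ℤ.- i))
  anticommTerm-star x y i = begin
    two * s * (s * X) * Y   ≈⟨ *-congʳ (*-assoc two s (s * X)) ⟩
    two * (s * (s * X)) * Y ≈⟨ *-congʳ (*-congˡ (*-assoc s s X)) ⟨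
    two * (s * s * X) * Y   ≈⟨ *-congʳ (*-congˡ (trans (*-congʳ (sgn*sgn≈1 ∣ i ∣)) (*-identityˡ X))) ⟩
    two * X * Y             ≈⟨ *-assoc two X Y ⟩
    two * (X * Y)           ∎
    where
    two s X Y : Carrier
    two = 1# + 1#
    s = sgnℤ i
    X = x (ℤ.- i)
    Y = y (ℤ.- i)

lemma3p4 : ∀ {c ℓ} (R : CommutativeRing c ℓ) (beta half : CommutativeRing.Carrier R) →
    CommutativeRing._≈_ R (CommutativeRing._*_ R half (CommutativeRing._+_ R (CommutativeRing.1# R) (CommutativeRing.1# R))) (CommutativeRing.1# R) →
    (m n : ℤ) →
    Fermions.HasSum R beta half (Fermions.anticommTerm R beta half (Fermions.star R beta half (Fermions.PhiP R beta half m)) (Fermions.phiB R beta half n)) (Fermions.δ R beta half m n)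
    × Fermions.HasSum R beta half (Fermions.anticommTerm R beta half (Fermions.star R beta half (Fermions.PhiB R beta half m)) (Fermions.phiP R beta half n)) (Fermions.δ R beta half m n)
lemma3p4 R beta half half*2≈1 m n =
    HasSum-cong (λ i → sym (anticommTerm-star (PhiP m) (phiB n) i)) (two*half≈1 (δ m n))
      (HasSum-reflect (HasSum-*ˡ two (pairing-HasSum m n)))
  , HasSum-cong mirrored (trans (two*half≈1 _) (δ-neg m n))
      (HasSum-*ˡ two (pairing-HasSum (ℤ.- m) (ℤ.- n)))
  where
  open CommutativeRing R hiding (zero)
  open Fermions R beta half
  open FermionsProperties R beta half
  two : Carrier
  two = 1# + 1#
  two*half≈1 : ∀ x → two * (half * x) ≈ x
  two*half≈1 x = trans (sym (*-assoc two half x)) (trans (*-congʳ (trans (*-comm two half) half*2≈1)) (*-identityˡ x))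
  mirrored : ∀ i → two * (PhiP (ℤ.- m) i * phiB (ℤ.- n) i) ≈ anticommTerm (star (PhiB m)) (phiP n) i
  mirrored i = sym (trans (anticommTerm-star (PhiB m) (phiP n) i) (*-congˡ (*-cong PhiB≈PhiP phiP≈phiB)))
    where
    PhiB≈PhiP : PhiB m (ℤ.- i) ≈ PhiP (ℤ.- m) i
    PhiB≈PhiP = trans (PhiB-mirror m (ℤ.- i)) (reflexive (≡.cong (PhiP (ℤ.- m)) (ℤ.neg-involutive i)))
    phiP≈phiB : phiP n (ℤ.- i) ≈ phiB (ℤ.- n) i
    phiP≈phiB = reflexive (≡.sym (≡.trans (phiB-mirror (ℤ.- n) i) (≡.cong (λ K → phiP K (ℤ.- i)) (ℤ.neg-involutive n))))
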